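{- Let $q=p^k$ be a prime power with $p\neq 2,3$. Then for every $D\in S_4(1,-1)\setminus\mathbb{F}_q$ we have $\eta_G(C(D))=\eta_{\mathbb{F}_{q^3}}(D^2+D+1)$; that is, $C(D)$ is a square in $G$ if and only if $D^2+D+1$ is a square in $\mathbb{F}_{q^3}$.
   Context: $N:\mathbb{F}_{q^3}\to\mathbb{F}_q$ is the norm $N(X)=X^{1+q+q^2}$, and $S_4(1,-1)=\{X\in\mathbb{F}_{q^3}: N(X)=1 \text{ and } N(X+1)=-1\}$. Work in an algebraic closure $\overline{\mathbb{F}}_q$ containing $\mathbb{F}_{q^2},\mathbb{F}_{q^3}$. Let $a$ be a fixed nontrivial third root of unity (root of $Y^2+Y+1$), $C(z)=\frac{z-a^{ -1}}{z-a}$, $e_q\in\{ -1,0,1\}$ with $q\equiv e_q\pmod 3$, and $G=\{x\in\overline{\mathbb{F}}_q: x^{3(q-e_q)}=1\}$ (a cyclic group; for $D\in S_4(1,-1)\setminus\mathbb{F}_q$ one has $C(D)\in G$). $\eta_G$ is the quadratic character of the cyclic group $G$: $\eta_G(x)=1$ if $x=y^2$ for some $y\in G$ and $-1$ otherwise. $\eta_{\mathbb{F}_{q^3}}$ is the quadratic character of $\mathbb{F}_{q^3}$ ($1$ on nonzero squares, $-1$ on nonsquares, $0$ at $0$). -}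

module Defs where

open import Level using (_⊔_)
open import Data.Nat as ℕ using (ℕ; suc; _%_; _∸_)
open import Data.List using (List; []; _∷_; length)
open import Data.Product using (Σ; _×_)
open import Relation.Nullary using (¬_)
open import Algebra.Bundles using (CommutativeRing; Semiring)
import Algebra.Definitions.RawSemiring as RS

-- Notions inside a commutative ring R (later assumed to be an algebraically
-- closed field of characteristic p, playing the role of the algebraic
-- closure of F_q).
module FieldNotions {c ℓ} (R : CommutativeRing c ℓ) where
  open CommutativeRing R
  open RS (Semiring.rawSemiring semiring) using (_^_) renaming (_×_ to _·ℕ_) public

  eval : List Carrier → Carrier → Carrier
  eval [] x = 0#
  eval (a ∷ as) x = a + x * eval as x

  -- R is a field of characteristic p which is algebraically closed:
  -- every monic polynomial x^n + c_{n-1} x^{n-1} + ... + c_0 with n ≥ 1 has a root.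
  record IsAlgClosedFieldOfChar (p : ℕ) : Set (c ⊔ ℓ) where
    field
      nontrivial : ¬ (1# ≈ 0#)
      inverse    : ∀ x → ¬ (x ≈ 0#) → Σ Carrier (λ y → x * y ≈ 1#)
      charP      : p ·ℕ 1# ≈ 0#
      algClosed  : ∀ (a : Carrier) (as : List Carrier) →
                   Σ Carrier (λ x → (x ^ suc (length as)) + eval (a ∷ as) x ≈ 0#)

  -- x ∈ F_{q^n}  (inside the algebraic closure) iff x^(q^n) = x
  InF : ℕ → Carrier → Set ℓ
  InF Q x = x ^ Q ≈ x

  N : ℕ → Carrier → Carrier
  N q X = X ^ (1 ℕ.+ q ℕ.+ q ℕ.* q)

  S4 : ℕ → Carrier → Set ℓ
  S4 q X = InF (q ℕ.^ 3) X × (N q X ≈ 1#) × (N q (X + 1#) ≈ - 1#)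

  -- order of the cyclic group G:  3 (q - e_q),  e_q ∈ {-1,0,1}, q ≡ e_q (mod 3)
  ordG : ℕ → ℕ
  ordG q with q % 3
  ... | 0 = 3 ℕ.* q
  ... | 1 = 3 ℕ.* (q ∸ 1)
  ... | _ = 3 ℕ.* (q ℕ.+ 1)

  InG : ℕ → Carrier → Set ℓ
  InG q x = x ^ ordG q ≈ 1#

  SquareInG : ℕ → Carrier → Set (c ⊔ ℓ)
  SquareInG q x = Σ Carrier (λ y → InG q y × (y * y ≈ x))

  NonzeroSquareInFq3 : ℕ → Carrier → Set (c ⊔ ℓ)
  NonzeroSquareInFq3 q x =
    ¬ (x ≈ 0#) × Σ Carrier (λ y → InF (q ℕ.^ 3) y × (y * y ≈ x))

-- Write y = D^q, z = y^q and X = D² + D + 1 = (D − a)(D − a²) = C(D)·(D − a)². The norm conditions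
-- Dyz = 1 and (D + 1)(y + 1)(z + 1) = −1 force (Dy + y + 1)(Dy + D + 1) = 0, and hence
-- (A − aB)(A − a²B) = 0 for A = (y − a²)(D − a) and B = (D − a²)(y − a). If q ≡ 1 (mod 6), then a^q = a,
-- A = C(D)^q·P and B = C(D)·P with P = (D − a)(y − a) ≠ 0, so C(D)^{3q} = C(D)³, i.e. C(D)^{3(q−1)} = 1;
-- if q ≡ 5 (mod 6), then a^q = a², B = C(D)^{1+q}·A, and C(D)^{3(q+1)} = 1. Moreover (D − a)^{q³−1} is 1,
-- respectively C(D), so X^{(q³−1)/2} = C(D)^{|G|/2}, and Euler's criterion in the cyclic groups G and
-- F_{q³}^× turns this equality of powers into the equivalence of the two square conditions. Finally
-- X ≠ 0, since otherwise D³ = 1 and q² ≡ 1 (mod 3) would put D in F_q.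
module Submission where

open import Defs
open import Level using (Level; _⊔_)
open import Data.Nat as ℕ using (ℕ; zero; suc; _∸_; _<_; z≤n; s≤s)
open import Data.Nat.Properties using (m^n≢0; +-suc; n∸n≡0)
open import Data.Nat.Divisibility using (_∣_; divides)
open import Data.Nat.Primality using (Prime; prime⇒nonZero)
open import Data.Product using (Σ; _×_; _,_; proj₁; proj₂)
open import Data.Maybe using (Maybe; just; nothing)
open import Data.List using ([]; _∷_)
open import Data.Fin using (Fin; toℕ; fromℕ; inject₁) renaming (zero to fzero; suc to fsuc)
open import Data.Fin.Properties using (toℕ-fromℕ; toℕ-inject₁; toℕ<n)
open import Function.Bundles using (_⇔_; mk⇔)
open import Function.Construct.Composition using (_⇔-∘_)
open import Function.Construct.Symmetry using (⇔-sym)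
open import Relation.Nullary using (¬_; yes; no)
open import Relation.Binary.PropositionalEquality as ≡ using (_≡_; _≢_)
open import Algebra.Bundles using (CommutativeRing; RawRing)
import Algebra.Solver.Ring.AlmostCommutativeRing as ACR

module Arithmetic where
  open import Data.Nat using (_+_; _*_; _^_; _%_; _≤_; _!; nonTrivial⇒≢1)
  open import Data.Nat.Properties using (<⇒≤; <⇒≱; n<1+n; <-trans; ∸-monoʳ-<; _!*_!≢0; *-assoc; *-identityʳ)
  open import Data.Nat.Divisibility using (∣⇒≤; ∣1⇒≡1; m∣m*n; n∣m*n; ∣-trans; ∣m∣n⇒∣m+n)
  open import Data.Nat.DivMod using (m/n*n≡m; _divMod_; result; [m+kn]%n≡m%n)
  open import Data.Nat.Primality using (euclidsLemma; prime⇒nonTrivial; prime⇒irreducible)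
  open import Data.Nat.Combinatorics using (_C_; nCk≡n!/k![n-k]!; k![n∸k]!∣n!)
  open import Data.Nat.Tactic.RingSolver using (solve-∀)
  open import Data.Fin using () renaming (zero to 0F; suc to 1+F)
  open import Data.Sum using (inj₁; inj₂)
  open import Data.Empty using (⊥-elim)

  prime∤! : ∀ {p} → Prime p → ∀ {m} → m < p → ¬ (p ∣ m !)
  prime∤! p-prime {zero} m<p p∣1 = nonTrivial⇒≢1 {{prime⇒nonTrivial p-prime}} (∣1⇒≡1 p∣1)
  prime∤! p-prime {suc m} m<p p∣[1+m]! with euclidsLemma (suc m) (m !) p-prime p∣[1+m]!
  ... | inj₁ p∣1+m = <⇒≱ m<p (∣⇒≤ p∣1+m)
  ... | inj₂ p∣m!  = prime∤! p-prime (<-trans (n<1+n m) m<p) p∣m!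

  nCk*k!*[n∸k]!≡n! : ∀ {n k} → k ≤ n → (n C k) * (k ! * (n ∸ k) !) ≡ n !
  nCk*k!*[n∸k]!≡n! {n} {k} k≤n = ≡.trans
    (≡.cong (_* (k ! * (n ∸ k) !)) (nCk≡n!/k![n-k]! k≤n))
    (m/n*n≡m {{k !* (n ∸ k) !≢0}} (k![n∸k]!∣n! k≤n))

  prime∣pCk : ∀ {p k} → Prime p → 0 < k → k < p → p ∣ p C k
  prime∣pCk {p@(suc p-1)} {k} p-prime 0<k k<p
    with euclidsLemma (p C k) (k ! * (p ∸ k) !) p-prime
           (≡.subst (p ∣_) (≡.sym (nCk*k!*[n∸k]!≡n! (<⇒≤ k<p))) (m∣m*n (p-1 !)))
  ... | inj₁ p∣pCk = p∣pCk
  ... | inj₂ p∣k!*[p∸k]! with euclidsLemma (k !) ((p ∸ k) !) p-prime p∣k!*[p∸k]!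
  ...   | inj₁ p∣k! = ⊥-elim (prime∤! p-prime k<p p∣k!)
  ...   | inj₂ p∣[p∸k]! = ⊥-elim (prime∤! p-prime (∸-monoʳ-< 0<k (<⇒≤ k<p)) p∣[p∸k]!)

  data CoprimeTo6 (q : ℕ) : Set where
    1+6n : ∀ n → q ≡ 1 + n * 6 → CoprimeTo6 q
    5+6n : ∀ n → q ≡ 5 + n * 6 → CoprimeTo6 q

  prime≡divisor-of-residue : ∀ {p d} r t → Prime p → p ≡ r + t * 6 →
                             suc (suc d) ∣ r → suc (suc d) ∣ 6 → p ≡ suc (suc d)
  prime≡divisor-of-residue {p} {d} r t p-prime p≡r+t*6 d∣r d∣6
    with prime⇒irreducible p-prime
           (≡.subst (suc (suc d) ∣_) (≡.sym p≡r+t*6) (∣m∣n⇒∣m+n d∣r (∣-trans d∣6 (n∣m*n t))))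
  ... | inj₂ d≡p = ≡.sym d≡p

  coprimeTo6-prime : ∀ {p} → Prime p → p ≢ 2 → p ≢ 3 → CoprimeTo6 p
  coprimeTo6-prime {p} p-prime p≢2 p≢3 with p divMod 6
  ... | result t 0F p≡ =
    ⊥-elim (p≢2 (prime≡divisor-of-residue 0 t p-prime p≡ (divides 0 ≡.refl) (divides 3 ≡.refl)))
  ... | result t (1+F 0F) p≡ = 1+6n t p≡
  ... | result t (1+F (1+F 0F)) p≡ =
    ⊥-elim (p≢2 (prime≡divisor-of-residue 2 t p-prime p≡ (divides 1 ≡.refl) (divides 3 ≡.refl)))
  ... | result t (1+F (1+F (1+F 0F))) p≡ =
    ⊥-elim (p≢3 (prime≡divisor-of-residue 3 t p-prime p≡ (divides 1 ≡.refl) (divides 2 ≡.refl)))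
  ... | result t (1+F (1+F (1+F (1+F 0F)))) p≡ =
    ⊥-elim (p≢2 (prime≡divisor-of-residue 4 t p-prime p≡ (divides 2 ≡.refl) (divides 3 ≡.refl)))
  ... | result t (1+F (1+F (1+F (1+F (1+F 0F))))) p≡ = 5+6n t p≡

  coprimeTo6-* : ∀ {m n} → CoprimeTo6 m → CoprimeTo6 n → CoprimeTo6 (m * n)
  coprimeTo6-* (1+6n i ≡.refl) (1+6n j ≡.refl) = 1+6n (i + j + i * j * 6) (eq i j)
    where eq : ∀ i j → (1 + i * 6) * (1 + j * 6) ≡ 1 + (i + j + i * j * 6) * 6
          eq = solve-∀
  coprimeTo6-* (1+6n i ≡.refl) (5+6n j ≡.refl) = 5+6n (j + 5 * i + i * j * 6) (eq i j)
    where eq : ∀ i j → (1 + i * 6) * (5 + j * 6) ≡ 5 + (j + 5 * i + i * j * 6) * 6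
          eq = solve-∀
  coprimeTo6-* (5+6n i ≡.refl) (1+6n j ≡.refl) = 5+6n (i + 5 * j + i * j * 6) (eq i j)
    where eq : ∀ i j → (5 + i * 6) * (1 + j * 6) ≡ 5 + (i + 5 * j + i * j * 6) * 6
          eq = solve-∀
  coprimeTo6-* (5+6n i ≡.refl) (5+6n j ≡.refl) = 1+6n (4 + 5 * i + 5 * j + i * j * 6) (eq i j)
    where eq : ∀ i j → (5 + i * 6) * (5 + j * 6) ≡ 1 + (4 + 5 * i + 5 * j + i * j * 6) * 6
          eq = solve-∀

  coprimeTo6-^ : ∀ {m} → CoprimeTo6 m → ∀ k → CoprimeTo6 (m ^ k)
  coprimeTo6-^ _ zero = 1+6n 0 ≡.refl
  coprimeTo6-^ m-coprime (suc k) = coprimeTo6-* m-coprime (coprimeTo6-^ m-coprime k)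

  n*n*n≡n^3 : ∀ n → n * n * n ≡ n ^ 3
  n*n*n≡n^3 n = ≡.trans (*-assoc n n n) (≡.cong (λ m → n * (n * m)) (≡.sym (*-identityʳ n)))

  [1+6n]%3≡1 : ∀ n → (1 + n * 6) % 3 ≡ 1
  [1+6n]%3≡1 n = ≡.trans (≡.cong (_% 3) (eq n)) ([m+kn]%n≡m%n 1 (n * 2) 3)
    where eq : ∀ n → 1 + n * 6 ≡ 1 + n * 2 * 3
          eq = solve-∀

  1+6n≡1+3[2n] : ∀ n → 1 + n * 6 ≡ 1 + 3 * (n * 2)
  1+6n≡1+3[2n] = solve-∀

  [1+6n]²≡1+3j : ∀ n → (1 + n * 6) * (1 + n * 6) ≡ 1 + 3 * (n * 4 + n * n * 12)
  [1+6n]²≡1+3j = solve-∀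

  [1+6n]³≡1+3j : ∀ n → (1 + n * 6) * (1 + n * 6) * (1 + n * 6) ≡ 1 + 3 * (n * 6 + n * n * 36 + n * n * n * 72)
  [1+6n]³≡1+3j = solve-∀

  [1+6n]*3≡3+18n : ∀ n → (1 + n * 6) * 3 ≡ 3 + (n * 9 + n * 9)
  [1+6n]*3≡3+18n = solve-∀

  3*6n≡9n+9n : ∀ n → 3 * (n * 6) ≡ n * 9 + n * 9
  3*6n≡9n+9n = solve-∀

  [1+6n]³≡1+2E : ∀ n → (1 + n * 6) * (1 + n * 6) * (1 + n * 6) ≡
    suc (n * 9 + (n * 9 + n * 9) * (n * n * 6 + n * 3) + (n * 9 + (n * 9 + n * 9) * (n * n * 6 + n * 3)))
  [1+6n]³≡1+2E = solve-∀

  [5+6n]%3≡2 : ∀ n → (5 + n * 6) % 3 ≡ 2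
  [5+6n]%3≡2 n = ≡.trans (≡.cong (_% 3) (eq n)) ([m+kn]%n≡m%n 2 (1 + n * 2) 3)
    where eq : ∀ n → 5 + n * 6 ≡ 2 + (1 + n * 2) * 3
          eq = solve-∀

  5+6n≡2+3[1+2n] : ∀ n → 5 + n * 6 ≡ 2 + 3 * (1 + n * 2)
  5+6n≡2+3[1+2n] = solve-∀

  [5+6n]²≡1+3j : ∀ n → (5 + n * 6) * (5 + n * 6) ≡ 1 + 3 * (8 + n * 20 + n * n * 12)
  [5+6n]²≡1+3j = solve-∀

  [5+6n]³≡2+3j : ∀ n → (5 + n * 6) * (5 + n * 6) * (5 + n * 6) ≡ 2 + 3 * (41 + n * 150 + n * n * 180 + n * n * n * 72)
  [5+6n]³≡2+3j = solve-∀

  [6+6n]*3≡18+18n : ∀ n → suc (5 + n * 6) * 3 ≡ (9 + n * 9) + (9 + n * 9)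
  [6+6n]*3≡18+18n = solve-∀

  3*[6+6n]≡18+18n : ∀ n → 3 * (5 + n * 6 + 1) ≡ (9 + n * 9) + (9 + n * 9)
  3*[6+6n]≡18+18n = solve-∀

  [5+6n]³≡1+2E : ∀ n → (5 + n * 6) * (5 + n * 6) * (5 + n * 6) ≡
    suc (8 + n * 9 + (9 + n * 9 + (9 + n * 9)) * (n * n * 6 + n * 9 + 3)
         + (8 + n * 9 + (9 + n * 9 + (9 + n * 9)) * (n * n * 6 + n * 9 + 3)))
  [5+6n]³≡1+2E = solve-∀

open Arithmetic

module IntegerSolver {c ℓ} (K : CommutativeRing c ℓ) where
  open CommutativeRing K hiding (zero)
  open import Algebra.Properties.Ring ring using (-0#≈0#; -‿+-comm; ⁻¹-anti-homo‿-; x[y-z]≈xy-xz; [y-z]x≈yx-zx)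
  open import Algebra.Properties.Semiring.Mult.TCOptimised semiring using (×-homo-+; ×1-homo-*) renaming (_×_ to _×′_)
  open import Algebra.Properties.CommutativeSemigroup +-commutativeSemigroup using (interchange)
  open import Relation.Binary.Reasoning.Setoid setoid

  -- The pair (m , n) stands for the integer m − n. The first clause makes the numeral (1 , 0)
  -- denote 1# itself, so that solver equations may use 1# rather than 1# − 0#.
  fromℤ : ℕ × ℕ → Carrier
  fromℤ (m , zero) = m ×′ 1#
  fromℤ (m , n) = m ×′ 1# - n ×′ 1#

  fromℤ-difference : ∀ m n → fromℤ (m , n) ≈ m ×′ 1# - n ×′ 1#
  fromℤ-difference m zero = sym (trans (+-congˡ -0#≈0#) (+-identityʳ _))
  fromℤ-difference m (suc n) = refl

  +-difference : ∀ a b c d → (a + c) - (b + d) ≈ (a - b) + (c - d)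
  +-difference a b c d = begin
    (a + c) - (b + d)      ≈⟨ +-congˡ (-‿+-comm b d) ⟨
    (a + c) + (- b + - d)  ≈⟨ interchange a c (- b) (- d) ⟩
    (a - b) + (c - d)      ∎

  *-difference : ∀ a b c d → (a * c + b * d) - (a * d + b * c) ≈ (a - b) * (c - d)
  *-difference a b c d = begin
    (a * c + b * d) - (a * d + b * c)  ≈⟨ +-congˡ (-‿cong (+-comm (a * d) (b * c))) ⟩
    (a * c + b * d) - (b * c + a * d)  ≈⟨ +-difference (a * c) (b * c) (b * d) (a * d) ⟩
    (a * c - b * c) + (b * d - a * d)  ≈⟨ +-congˡ (⁻¹-anti-homo‿- (a * d) (b * d)) ⟨
    (a * c - b * c) - (a * d - b * d)  ≈⟨ +-cong ([y-z]x≈yx-zx c a b) (-‿cong ([y-z]x≈yx-zx d a b)) ⟨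
    (a - b) * c - (a - b) * d          ≈⟨ x[y-z]≈xy-xz (a - b) c d ⟨
    (a - b) * (c - d)                  ∎

  difference-cong : ∀ {a b c d} → a + d ≈ c + b → a - b ≈ c - d
  difference-cong {a} {b} {c} {d} a+d≈c+b = begin
    a - b              ≈⟨ +-identityʳ _ ⟨
    (a - b) + 0#       ≈⟨ +-congˡ (-‿inverseʳ d) ⟨
    (a - b) + (d - d)  ≈⟨ +-difference a b d d ⟨
    (a + d) - (b + d)  ≈⟨ +-cong a+d≈c+b (-‿cong (+-comm b d)) ⟩
    (c + b) - (d + b)  ≈⟨ +-difference c d b b ⟩
    (c - d) + (b - b)  ≈⟨ +-congˡ (-‿inverseʳ b) ⟩
    (c - d) + 0#       ≈⟨ +-identityʳ _ ⟩
    c - d              ∎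

  fromℤ-cong : ∀ {m n m′ n′} → m ℕ.+ n′ ≡ m′ ℕ.+ n → fromℤ (m , n) ≈ fromℤ (m′ , n′)
  fromℤ-cong {m} {n} {m′} {n′} m+n′≡m′+n = begin
    fromℤ (m , n)        ≈⟨ fromℤ-difference m n ⟩
    m ×′ 1# - n ×′ 1#    ≈⟨ difference-cong (begin
      m ×′ 1# + n′ ×′ 1#  ≈⟨ ×-homo-+ 1# m n′ ⟨
      (m ℕ.+ n′) ×′ 1#    ≡⟨ ≡.cong (_×′ 1#) m+n′≡m′+n ⟩
      (m′ ℕ.+ n) ×′ 1#    ≈⟨ ×-homo-+ 1# m′ n ⟩
      m′ ×′ 1# + n ×′ 1#  ∎) ⟩
    m′ ×′ 1# - n′ ×′ 1#  ≈⟨ fromℤ-difference m′ n′ ⟨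
    fromℤ (m′ , n′)      ∎

  -- The solver compares normal forms up to definitional equality, so the coefficient
  -- operations must return canonical pairs.
  canonical : ℕ × ℕ → ℕ × ℕ
  canonical (suc m , suc n) = canonical (m , n)
  canonical i = i

  fromℤ-canonical : ∀ i → fromℤ (canonical i) ≈ fromℤ i
  fromℤ-canonical (zero , n) = refl
  fromℤ-canonical (suc m , zero) = refl
  fromℤ-canonical (suc m , suc n) = trans (fromℤ-canonical (m , n)) (fromℤ-cong {m} {n} (+-suc m n))

  _+ℤ_ _*ℤ_ : ℕ × ℕ → ℕ × ℕ → ℕ × ℕ
  (m , n) +ℤ (m′ , n′) = canonical (m ℕ.+ m′ , n ℕ.+ n′)
  (m , n) *ℤ (m′ , n′) = canonical (m ℕ.* m′ ℕ.+ n ℕ.* n′ , m ℕ.* n′ ℕ.+ n ℕ.* m′)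

  -ℤ_ : ℕ × ℕ → ℕ × ℕ
  -ℤ (m , n) = (n , m)

  ℤ-rawRing : RawRing _ _
  ℤ-rawRing = record
    { Carrier = ℕ × ℕ ; _≈_ = _≡_ ; _+_ = _+ℤ_ ; _*_ = _*ℤ_ ; -_ = -ℤ_ ; 0# = (0 , 0) ; 1# = (1 , 0) }

  fromℤ-+ : ∀ i j → fromℤ (i +ℤ j) ≈ fromℤ i + fromℤ j
  fromℤ-+ (m , n) (m′ , n′) = begin
    fromℤ (canonical (m ℕ.+ m′ , n ℕ.+ n′))      ≈⟨ fromℤ-canonical (m ℕ.+ m′ , n ℕ.+ n′) ⟩
    fromℤ (m ℕ.+ m′ , n ℕ.+ n′)                  ≈⟨ fromℤ-difference (m ℕ.+ m′) (n ℕ.+ n′) ⟩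
    (m ℕ.+ m′) ×′ 1# - (n ℕ.+ n′) ×′ 1#
      ≈⟨ +-cong (×-homo-+ 1# m m′) (-‿cong (×-homo-+ 1# n n′)) ⟩
    (m ×′ 1# + m′ ×′ 1#) - (n ×′ 1# + n′ ×′ 1#)  ≈⟨ +-difference _ _ _ _ ⟩
    (m ×′ 1# - n ×′ 1#) + (m′ ×′ 1# - n′ ×′ 1#)
      ≈⟨ +-cong (fromℤ-difference m n) (fromℤ-difference m′ n′) ⟨
    fromℤ (m , n) + fromℤ (m′ , n′)              ∎

  fromℤ-* : ∀ i j → fromℤ (i *ℤ j) ≈ fromℤ i * fromℤ j
  fromℤ-* (m , n) (m′ , n′) = begin
    fromℤ (canonical (mm′+nn′ , mn′+nm′))  ≈⟨ fromℤ-canonical (mm′+nn′ , mn′+nm′) ⟩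
    fromℤ (mm′+nn′ , mn′+nm′)              ≈⟨ fromℤ-difference mm′+nn′ mn′+nm′ ⟩
    mm′+nn′ ×′ 1# - mn′+nm′ ×′ 1#
      ≈⟨ +-cong (trans (×-homo-+ 1# (m ℕ.* m′) (n ℕ.* n′)) (+-cong (×1-homo-* m m′) (×1-homo-* n n′)))
                (-‿cong (trans (×-homo-+ 1# (m ℕ.* n′) (n ℕ.* m′))
                               (+-cong (×1-homo-* m n′) (×1-homo-* n m′)))) ⟩
    (M * M′ + N * N′) - (M * N′ + N * M′)  ≈⟨ *-difference M N M′ N′ ⟩
    (M - N) * (M′ - N′)                    ≈⟨ *-cong (fromℤ-difference m n) (fromℤ-difference m′ n′) ⟨
    fromℤ (m , n) * fromℤ (m′ , n′)        ∎
    where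
    mm′+nn′ mn′+nm′ : ℕ
    mm′+nn′ = m ℕ.* m′ ℕ.+ n ℕ.* n′
    mn′+nm′ = m ℕ.* n′ ℕ.+ n ℕ.* m′
    M N M′ N′ : Carrier
    M = m ×′ 1#
    N = n ×′ 1#
    M′ = m′ ×′ 1#
    N′ = n′ ×′ 1#

  fromℤ-negate : ∀ i → fromℤ (-ℤ i) ≈ - fromℤ i
  fromℤ-negate (m , n) = begin
    fromℤ (n , m)          ≈⟨ fromℤ-difference n m ⟩
    n ×′ 1# - m ×′ 1#      ≈⟨ ⁻¹-anti-homo‿- (m ×′ 1#) (n ×′ 1#) ⟨
    - (m ×′ 1# - n ×′ 1#)  ≈⟨ -‿cong (fromℤ-difference m n) ⟨
    - fromℤ (m , n)        ∎

  homomorphism : ℤ-rawRing ACR.-Raw-AlmostCommutative⟶ ACR.fromCommutativeRing K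
  homomorphism = record
    { ⟦_⟧ = fromℤ ; +-homo = fromℤ-+ ; *-homo = fromℤ-* ; -‿homo = fromℤ-negate ; 0-homo = refl ; 1-homo = refl }

  fromℤ-≟ : ∀ i j → Maybe (fromℤ i ≈ fromℤ j)
  fromℤ-≟ (m , n) (m′ , n′) with m ℕ.+ n′ ℕ.≟ m′ ℕ.+ n
  ... | no _ = nothing
  ... | yes m+n′≡m′+n = just (fromℤ-cong {m} {n} m+n′≡m′+n)

  open import Algebra.Solver.Ring ℤ-rawRing (ACR.fromCommutativeRing K) homomorphism fromℤ-≟ public

  :0 :1 : ∀ {n} → Polynomial n
  :0 = con (0 , 0)
  :1 = con (1 , 0)

module _ {c ℓ} (K : CommutativeRing c ℓ) where
  open CommutativeRing K hiding (zero)
  open FieldNotions K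
  open IntegerSolver K using (solve; _:=_; _:+_; _:*_; :-_; _:-_; :0; :1)
  open import Algebra.Properties.Semiring.Mult semiring using (×-cong; ×-congˡ; ×-congʳ; ×-homo-1; ×1-homo-*; ×-comm-*)
  open import Algebra.Properties.Semiring.Exp semiring using (^-congˡ; ^-congʳ; ^-homo-*; ^-assocʳ)
  open import Algebra.Properties.CommutativeSemiring.Exp commutativeSemiring using (^-distrib-*)
  open import Algebra.Properties.CommutativeSemiring.Binomial commutativeSemiring using (theorem; binomialTerm)
  open import Algebra.Properties.Monoid.Sum +-monoid using (sum; sum-init-last; sum-cong-≋; sum-replicate-zero)
  open import Algebra.Properties.Group +-group using (x≈y⇒x∙y⁻¹≈ε; x∙y⁻¹≈ε⇒x≈y; inverseʳ-unique)
  open import Relation.Binary.Reasoning.Setoid setoid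

  1#^n≈1# : ∀ n → 1# ^ n ≈ 1#
  1#^n≈1# zero = refl
  1#^n≈1# (suc n) = trans (*-identityˡ _) (1#^n≈1# n)

  ^-mod : ∀ {w} m {n} r j → w ^ m ≈ 1# → n ≡ r ℕ.+ m ℕ.* j → w ^ n ≈ w ^ r
  ^-mod {w} m {n} r j w^m≈1 n≡r+mj = begin
    w ^ n                  ≡⟨ ≡.cong (w ^_) n≡r+mj ⟩
    w ^ (r ℕ.+ m ℕ.* j)    ≈⟨ ^-homo-* w r (m ℕ.* j) ⟩
    w ^ r * w ^ (m ℕ.* j)  ≈⟨ *-congˡ (^-assocʳ w m j) ⟨
    w ^ r * (w ^ m) ^ j    ≈⟨ *-congˡ (^-congˡ j w^m≈1) ⟩
    w ^ r * 1# ^ j         ≈⟨ *-congˡ (1#^n≈1# j) ⟩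
    w ^ r * 1#             ≈⟨ *-identityʳ _ ⟩
    w ^ r                  ∎

  [w*w]^n≈w^[n+n] : ∀ w n → (w * w) ^ n ≈ w ^ (n ℕ.+ n)
  [w*w]^n≈w^[n+n] w n = trans (^-distrib-* w w n) (sym (^-homo-* w n n))

  *-≉0ˡ : ∀ {u v} → ¬ (u * v ≈ 0#) → ¬ (u ≈ 0#)
  *-≉0ˡ {u} {v} uv≉0 u≈0 = uv≉0 (trans (*-congʳ u≈0) (zeroˡ v))

  *-≉0ʳ : ∀ {u v} → ¬ (u * v ≈ 0#) → ¬ (v ≈ 0#)
  *-≉0ʳ {u} {v} uv≉0 v≈0 = uv≉0 (trans (*-congˡ v≈0) (zeroʳ u))

  drop-multiple : ∀ {h u v w} → h ≈ 0# → u ≈ v + w * h → u ≈ v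
  drop-multiple {h} {u} {v} {w} h≈0 u≈v+wh = begin
    u           ≈⟨ u≈v+wh ⟩
    v + w * h   ≈⟨ +-congˡ (*-congˡ h≈0) ⟩
    v + w * 0#  ≈⟨ +-congˡ (zeroʳ w) ⟩
    v + 0#      ≈⟨ +-identityʳ v ⟩
    v           ∎

  norm-equations⇒[xy+y+1][xy+x+1]≈0 : ∀ {x y z} → x * (y * z) ≈ 1# → (x + 1#) * ((y + 1#) * (z + 1#)) ≈ - 1# →
                                      (x * y + y + 1#) * (x * y + x + 1#) ≈ 0#
  norm-equations⇒[xy+y+1][xy+x+1]≈0 {x} {y} {z} xyz≈1 [x+1][y+1][z+1]≈-1 =
    drop-multiple (x≈y⇒x∙y⁻¹≈ε xyz≈1) (drop-multiple (trans (+-congʳ [x+1][y+1][z+1]≈-1) (-‿inverseˡ 1#))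
      (solve 3 (λ x y z → (x :* y :+ y :+ :1) :* (x :* y :+ x :+ :1) :=
         (:0 :+ (:- (x :* y :+ :1 :+ x :+ y)) :* (x :* (y :* z) :- :1))
         :+ (x :* y) :* ((x :+ :1) :* ((y :+ :1) :* (z :+ :1)) :+ :1)) refl x y z))

  AdditivePower : ℕ → Set (c ⊔ ℓ)
  AdditivePower n = ∀ x y → (x + y) ^ n ≈ x ^ n + y ^ n

  inner-binomialTerms≈0⇒additive : ∀ {m} →
    (∀ x y (i : Fin m) → binomialTerm x y (suc m) (fsuc (inject₁ i)) ≈ 0#) → AdditivePower (suc m)
  inner-binomialTerms≈0⇒additive {m} inner≈0 x y = begin
    (x + y) ^ n                                     ≈⟨ theorem n x y ⟩
    term fzero + sum (λ i → term (fsuc i))          ≈⟨ +-cong first (sum-init-last (λ i → term (fsuc i))) ⟩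
    y ^ n + (sum (λ i → term (fsuc (inject₁ i))) + term (fsuc (fromℕ m)))
                                                    ≈⟨ +-congˡ (+-cong inner last) ⟩
    y ^ n + (0# + x ^ n)                            ≈⟨ +-congˡ (+-identityˡ _) ⟩
    y ^ n + x ^ n                                   ≈⟨ +-comm _ _ ⟩
    x ^ n + y ^ n                                   ∎
    where
    open import Data.Nat.Combinatorics using (_C_; nCn≡1; nCk≡nC[n∸k])
    n : ℕ
    n = suc m
    term : Fin (suc n) → Carrier
    term = binomialTerm x y n
    first : term fzero ≈ y ^ n
    first = begin
      (n C 0) ·ℕ (1# * y ^ n)  ≈⟨ ×-congˡ (≡.trans (nCk≡nC[n∸k] {0} {n} z≤n) (nCn≡1 n)) ⟩
      1 ·ℕ (1# * y ^ n)        ≈⟨ ×-homo-1 _ ⟩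
      1# * y ^ n               ≈⟨ *-identityˡ _ ⟩
      y ^ n                    ∎
    last : term (fsuc (fromℕ m)) ≈ x ^ n
    last = begin
      (n C toℕ (fsuc (fromℕ m))) ·ℕ (x ^ toℕ (fsuc (fromℕ m)) * y ^ (n ∸ toℕ (fsuc (fromℕ m))))
        ≈⟨ ×-cong (≡.cong (n C_) toℕ≡n) (*-cong (^-congʳ x toℕ≡n) (^-congʳ y (≡.cong (n ∸_) toℕ≡n))) ⟩
      (n C n) ·ℕ (x ^ n * y ^ (n ∸ n))  ≈⟨ ×-congˡ (nCn≡1 n) ⟩
      1 ·ℕ (x ^ n * y ^ (n ∸ n))        ≈⟨ ×-homo-1 _ ⟩
      x ^ n * y ^ (n ∸ n)               ≈⟨ *-congˡ (^-congʳ y (n∸n≡0 n)) ⟩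
      x ^ n * 1#                        ≈⟨ *-identityʳ _ ⟩
      x ^ n                             ∎
      where
      toℕ≡n : toℕ (fsuc (fromℕ m)) ≡ n
      toℕ≡n = ≡.cong suc (toℕ-fromℕ m)
    inner : sum (λ i → term (fsuc (inject₁ i))) ≈ 0#
    inner = trans (sum-cong-≋ (inner≈0 x y)) (sum-replicate-zero m)

  char∣n⇒n·ℕx≈0 : ∀ {p n} → p ·ℕ 1# ≈ 0# → p ∣ n → ∀ x → n ·ℕ x ≈ 0#
  char∣n⇒n·ℕx≈0 {p} p·1≈0 (divides k ≡.refl) x = begin
    (k ℕ.* p) ·ℕ x            ≈⟨ ×-congʳ (k ℕ.* p) (*-identityʳ x) ⟨
    (k ℕ.* p) ·ℕ (x * 1#)     ≈⟨ ×-comm-* (k ℕ.* p) x 1# ⟨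
    x * ((k ℕ.* p) ·ℕ 1#)     ≈⟨ *-congˡ (×1-homo-* k p) ⟩
    x * (k ·ℕ 1# * p ·ℕ 1#)   ≈⟨ *-congˡ (*-congˡ p·1≈0) ⟩
    x * (k ·ℕ 1# * 0#)        ≈⟨ *-congˡ (zeroʳ _) ⟩
    x * 0#                    ≈⟨ zeroʳ x ⟩
    0#                        ∎

  frobenius : ∀ {p} → Prime p → p ·ℕ 1# ≈ 0# → AdditivePower p
  frobenius {zero} p-prime with () ← prime⇒nonZero p-prime
  frobenius {suc m} p-prime p·1≈0 = inner-binomialTerms≈0⇒additive λ x y i →
    char∣n⇒n·ℕx≈0 p·1≈0
      (prime∣pCk p-prime (s≤s z≤n) (s≤s (≡.subst (_< m) (≡.sym (toℕ-inject₁ i)) (toℕ<n i)))) _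

  additivePower-1 : AdditivePower 1
  additivePower-1 x y = trans (*-identityʳ _) (sym (+-cong (*-identityʳ x) (*-identityʳ y)))

  additivePower-* : ∀ {m n} → AdditivePower m → AdditivePower n → AdditivePower (m ℕ.* n)
  additivePower-* {m} {n} additive-m additive-n x y = begin
    (x + y) ^ (m ℕ.* n)            ≈⟨ ^-assocʳ (x + y) m n ⟨
    ((x + y) ^ m) ^ n              ≈⟨ ^-congˡ n (additive-m x y) ⟩
    (x ^ m + y ^ m) ^ n            ≈⟨ additive-n _ _ ⟩
    (x ^ m) ^ n + (y ^ m) ^ n      ≈⟨ +-cong (^-assocʳ x m n) (^-assocʳ y m n) ⟩
    x ^ (m ℕ.* n) + y ^ (m ℕ.* n)  ∎

  additivePower-^ : ∀ {m} → AdditivePower m → ∀ k → AdditivePower (m ℕ.^ k)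
  additivePower-^ _ zero = additivePower-1
  additivePower-^ {m} additive-m (suc k) = additivePower-* {m} {m ℕ.^ k} additive-m (additivePower-^ additive-m k)

  additivePower-- : ∀ {n} .{{_ : ℕ.NonZero n}} → AdditivePower n → ∀ x y → (x - y) ^ n ≈ x ^ n - y ^ n
  additivePower-- {suc n} additive x y = trans (additive x (- y)) (+-congˡ (inverseʳ-unique _ _ (begin
    y ^ suc n + (- y) ^ suc n  ≈⟨ additive y (- y) ⟨
    (y - y) ^ suc n            ≈⟨ ^-congˡ (suc n) (-‿inverseʳ y) ⟩
    0# * 0# ^ n                ≈⟨ zeroˡ _ ⟩
    0#                         ∎)))

  module Field (nontrivial : ¬ (1# ≈ 0#)) (inverse : ∀ x → ¬ (x ≈ 0#) → Σ Carrier (λ y → x * y ≈ 1#)) where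

    *-cancelˡ : ∀ {z u v} → ¬ (z ≈ 0#) → z * u ≈ z * v → u ≈ v
    *-cancelˡ {z} {u} {v} z≉0 zu≈zv with inverse z z≉0
    ... | z⁻¹ , zz⁻¹≈1 = begin
      u               ≈⟨ *-identityˡ u ⟨
      1# * u          ≈⟨ *-congʳ (trans (sym zz⁻¹≈1) (*-comm z z⁻¹)) ⟩
      (z⁻¹ * z) * u   ≈⟨ *-assoc z⁻¹ z u ⟩
      z⁻¹ * (z * u)   ≈⟨ *-congˡ zu≈zv ⟩
      z⁻¹ * (z * v)   ≈⟨ *-assoc z⁻¹ z v ⟨
      (z⁻¹ * z) * v   ≈⟨ *-congʳ (trans (*-comm z⁻¹ z) zz⁻¹≈1) ⟩
      1# * v          ≈⟨ *-identityˡ v ⟩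
      v               ∎

    *≈0⇒≈0 : ∀ {u v} → ¬ (u ≈ 0#) → u * v ≈ 0# → v ≈ 0#
    *≈0⇒≈0 u≉0 uv≈0 = *-cancelˡ u≉0 (trans uv≈0 (sym (zeroʳ _)))

    *-≉0 : ∀ {u v} → ¬ (u ≈ 0#) → ¬ (v ≈ 0#) → ¬ (u * v ≈ 0#)
    *-≉0 u≉0 v≉0 uv≈0 = v≉0 (*≈0⇒≈0 u≉0 uv≈0)

    ^-≉0 : ∀ {u} → ¬ (u ≈ 0#) → ∀ n → ¬ (u ^ n ≈ 0#)
    ^-≉0 u≉0 zero = nontrivial
    ^-≉0 u≉0 (suc n) = *-≉0 u≉0 (^-≉0 u≉0 n)

    module EulerCriterion (sqrt : ∀ x → Σ Carrier (λ y → y * y ≈ x)) where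

      squareOfRoot⇔ : ∀ {m} h → m ≡ h ℕ.+ h → ∀ c →
                      Σ Carrier (λ y → y ^ m ≈ 1# × y * y ≈ c) ⇔ c ^ h ≈ 1#
      squareOfRoot⇔ {m} h m≡h+h c = mk⇔ to from
        where
        to : Σ Carrier (λ y → y ^ m ≈ 1# × y * y ≈ c) → c ^ h ≈ 1#
        to (y , y^m≈1 , yy≈c) = begin
          c ^ h          ≈⟨ ^-congˡ h yy≈c ⟨
          (y * y) ^ h    ≈⟨ [w*w]^n≈w^[n+n] y h ⟩
          y ^ (h ℕ.+ h)  ≈⟨ ^-congʳ y m≡h+h ⟨
          y ^ m          ≈⟨ y^m≈1 ⟩
          1#             ∎
        from : c ^ h ≈ 1# → Σ Carrier (λ y → y ^ m ≈ 1# × y * y ≈ c)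
        from c^h≈1 = let (y , yy≈c) = sqrt c in y , (begin
          y ^ m          ≈⟨ ^-congʳ y m≡h+h ⟩
          y ^ (h ℕ.+ h)  ≈⟨ [w*w]^n≈w^[n+n] y h ⟨
          (y * y) ^ h    ≈⟨ ^-congˡ h yy≈c ⟩
          c ^ h          ≈⟨ c^h≈1 ⟩
          1#             ∎) , yy≈c

      fixedSquare⇔ : ∀ {Q} E → Q ≡ suc (E ℕ.+ E) → ∀ {c} → ¬ (c ≈ 0#) →
                     (¬ (c ≈ 0#) × Σ Carrier (λ w → w ^ Q ≈ w × w * w ≈ c)) ⇔ c ^ E ≈ 1#
      fixedSquare⇔ {Q} E Q≡1+E+E {c} c≉0 = mk⇔ to from
        where
        w^Q≈w*c^E : ∀ {w} → w * w ≈ c → w ^ Q ≈ w * c ^ E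
        w^Q≈w*c^E {w} ww≈c = begin
          w ^ Q                ≈⟨ ^-congʳ w Q≡1+E+E ⟩
          w * w ^ (E ℕ.+ E)    ≈⟨ *-congˡ ([w*w]^n≈w^[n+n] w E) ⟨
          w * (w * w) ^ E      ≈⟨ *-congˡ (^-congˡ E ww≈c) ⟩
          w * c ^ E            ∎
        to : (¬ (c ≈ 0#) × Σ Carrier (λ w → w ^ Q ≈ w × w * w ≈ c)) → c ^ E ≈ 1#
        to (_ , w , w^Q≈w , ww≈c) = *-cancelˡ w≉0 (begin
          w * c ^ E  ≈⟨ w^Q≈w*c^E ww≈c ⟨
          w ^ Q      ≈⟨ w^Q≈w ⟩
          w          ≈⟨ *-identityʳ w ⟨
          w * 1#     ∎)
          where
          w≉0 : ¬ (w ≈ 0#)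
          w≉0 w≈0 = c≉0 (trans (sym ww≈c) (trans (*-congʳ w≈0) (zeroˡ w)))
        from : c ^ E ≈ 1# → ¬ (c ≈ 0#) × Σ Carrier (λ w → w ^ Q ≈ w × w * w ≈ c)
        from c^E≈1 = let (w , ww≈c) = sqrt c in
          c≉0 , w , trans (w^Q≈w*c^E ww≈c) (trans (*-congˡ c^E≈1) (*-identityʳ w)) , ww≈c

      squares-agree : ∀ q h E → ordG q ≡ h ℕ.+ h → q ℕ.^ 3 ≡ suc (E ℕ.+ E) →
                      ∀ {c d} → ¬ (d ≈ 0#) → c ^ h ≈ d ^ E → SquareInG q c ⇔ NonzeroSquareInFq3 q d
      squares-agree q h E ordG≡h+h q³≡1+E+E {c} d≉0 c^h≈d^E =
        ⇔-sym (fixedSquare⇔ E q³≡1+E+E d≉0)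
          ⇔-∘ (mk⇔ (trans (sym c^h≈d^E)) (trans c^h≈d^E) ⇔-∘ squareOfRoot⇔ h ordG≡h+h c)

  square-root : ∀ {p} → IsAlgClosedFieldOfChar p → ∀ x → Σ Carrier (λ y → y * y ≈ x)
  square-root F x with IsAlgClosedFieldOfChar.algClosed F (- x) (0# ∷ [])
  ... | y , y²-x≈0 = y , x∙y⁻¹≈ε⇒x≈y (y * y) x (trans (sym monic-quadratic) y²-x≈0)
    where
    monic-quadratic : y ^ 2 + (- x + y * (0# + y * 0#)) ≈ y * y - x
    monic-quadratic = solve 2 (λ y x → y :* (y :* :1) :+ (:- x :+ y :* (:0 :+ y :* :0))
                                        := y :* y :- x) refl y x

  ordG-1mod3 : ∀ {r} → r ℕ.% 3 ≡ 1 → ordG r ≡ 3 ℕ.* (r ∸ 1)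
  ordG-1mod3 r%3≡1 rewrite r%3≡1 = ≡.refl

  ordG-2mod3 : ∀ {r} → r ℕ.% 3 ≡ 2 → ordG r ≡ 3 ℕ.* (r ℕ.+ 1)
  ordG-2mod3 r%3≡2 rewrite r%3≡2 = ≡.refl

  module CubeRootOfUnity (a : Carrier) (a²+a+1≈0 : a * a + a + 1# ≈ 0#) where

    a³≈1 : a ^ 3 ≈ 1#
    a³≈1 = drop-multiple a²+a+1≈0
      (solve 1 (λ a → a :* (a :* (a :* :1)) := :1 :+ (a :- :1) :* (a :* a :+ a :+ :1)) refl a)

    [a*a]*[a*a]≈a : (a * a) * (a * a) ≈ a
    [a*a]*[a*a]≈a = drop-multiple a²+a+1≈0
      (solve 1 (λ a → (a :* a) :* (a :* a) := a :+ (a :* (a :- :1)) :* (a :* a :+ a :+ :1)) refl a)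

    [x-a][x-a*a]≈x²+x+1 : ∀ x → (x - a) * (x - a * a) ≈ x * x + x + 1#
    [x-a][x-a*a]≈x²+x+1 x = drop-multiple a²+a+1≈0
      (solve 2 (λ x a → (x :- a) :* (x :- a :* a) :=
                        (x :* x :+ x :+ :1) :+ (a :- :1 :- x) :* (a :* a :+ a :+ :1)) refl x a)

    [t-as][t-aas]≈0⇒t³≈s³ : ∀ {t s} → (t - a * s) * (t - a * a * s) ≈ 0# → t ^ 3 ≈ s ^ 3
    [t-as][t-aas]≈0⇒t³≈s³ {t} {s} factors≈0 = drop-multiple a²+a+1≈0 (drop-multiple factors≈0
      (solve 3 (λ t s a → t :* (t :* (t :* :1)) :=
          (s :* (s :* (s :* :1)) :+ (t :- s) :* (t :* s :- (a :- :1) :* s :* s) :* (a :* a :+ a :+ :1))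
          :+ (t :- s) :* ((t :- a :* s) :* (t :- a :* a :* s))) refl t s a))

    [xy+y+1][xy+x+1]≈0⇒[A-aB][A-aaB]≈0 : ∀ x y → (x * y + y + 1#) * (x * y + x + 1#) ≈ 0# →
      ((y - a * a) * (x - a) - a * ((x - a * a) * (y - a))) *
      ((y - a * a) * (x - a) - a * a * ((x - a * a) * (y - a))) ≈ 0#
    [xy+y+1][xy+x+1]≈0⇒[A-aB][A-aaB]≈0 x y factors≈0 = begin
      (A - a * B) * (A - a * a * B)                                      ≈⟨ *-cong A-aB≈ A-aaB≈ ⟩
      ((1# - a) * (x * y + y + 1#)) * ((1# - a * a) * (x * y + x + 1#))
        ≈⟨ solve 3 (λ x y a → ((:1 :- a) :* (x :* y :+ y :+ :1)) :* ((:1 :- a :* a) :* (x :* y :+ x :+ :1)) :=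
                              ((:1 :- a) :* (:1 :- a :* a)) :* ((x :* y :+ y :+ :1) :* (x :* y :+ x :+ :1)))
                   refl x y a ⟩
      ((1# - a) * (1# - a * a)) * ((x * y + y + 1#) * (x * y + x + 1#))  ≈⟨ *-congˡ factors≈0 ⟩
      ((1# - a) * (1# - a * a)) * 0#                                     ≈⟨ zeroʳ _ ⟩
      0#                                                                 ∎
      where
      A B : Carrier
      A = (y - a * a) * (x - a)
      B = (x - a * a) * (y - a)
      A-aB≈ : A - a * B ≈ (1# - a) * (x * y + y + 1#)
      A-aB≈ = drop-multiple a²+a+1≈0 (solve 3 (λ x y a →
        (y :- a :* a) :* (x :- a) :- a :* ((x :- a :* a) :* (y :- a)) :=
        (:1 :- a) :* (x :* y :+ y :+ :1) :+ ((y :+ :1 :- a) :* (a :- :1)) :* (a :* a :+ a :+ :1))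
        refl x y a)
      A-aaB≈ : A - a * a * B ≈ (1# - a * a) * (x * y + x + 1#)
      A-aaB≈ = drop-multiple a²+a+1≈0 (solve 3 (λ x y a →
        (y :- a :* a) :* (x :- a) :- a :* a :* ((x :- a :* a) :* (y :- a)) :=
        (:1 :- a :* a) :* (x :* y :+ x :+ :1) :+ ((a :* y :+ x :+ :1 :- a :* a) :* (a :- :1)) :* (a :* a :+ a :+ :1))
        refl x y a)

  module Setting {p} (F : IsAlgClosedFieldOfChar p)
    (q : ℕ) .{{_ : ℕ.NonZero q}} (additive-q : AdditivePower q)
    (a : Carrier) (a²+a+1≈0 : a * a + a + 1# ≈ 0#)
    (x : Carrier) (x∈S4 : S4 q x) (x∉Fq : ¬ InF q x)
    (C : Carrier) (C-def : C * (x - a) ≈ x - a * a) where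
    open IsAlgClosedFieldOfChar F using (nontrivial; inverse)
    open Field nontrivial inverse
    open EulerCriterion (square-root F)
    open CubeRootOfUnity a a²+a+1≈0

    y X u : Carrier
    y = x ^ q
    X = x * x + x + 1#
    u = x - a

    N≈w*w^q*[w^q]^q : ∀ w → N q w ≈ w * (w ^ q * (w ^ q) ^ q)
    N≈w*w^q*[w^q]^q w = begin
      w ^ (1 ℕ.+ q ℕ.+ q ℕ.* q)      ≈⟨ ^-homo-* w (1 ℕ.+ q) (q ℕ.* q) ⟩
      w ^ (1 ℕ.+ q) * w ^ (q ℕ.* q)  ≈⟨ *-congˡ (^-assocʳ w q q) ⟨
      (w * w ^ q) * (w ^ q) ^ q      ≈⟨ *-assoc _ _ _ ⟩
      w * (w ^ q * (w ^ q) ^ q)      ∎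

    [w+1]^q≈w^q+1 : ∀ w → (w + 1#) ^ q ≈ w ^ q + 1#
    [w+1]^q≈w^q+1 w = trans (additive-q w 1#) (+-congˡ (1#^n≈1# q))

    [xy+y+1][xy+x+1]≈0 : (x * y + y + 1#) * (x * y + x + 1#) ≈ 0#
    [xy+y+1][xy+x+1]≈0 = norm-equations⇒[xy+y+1][xy+x+1]≈0
      (trans (sym (N≈w*w^q*[w^q]^q x)) (proj₁ (proj₂ x∈S4))) (begin
      (x + 1#) * ((y + 1#) * (y ^ q + 1#))            ≈⟨ *-congˡ (*-cong ([w+1]^q≈w^q+1 x) ([w+1]^q≈w^q+1 y)) ⟨
      (x + 1#) * ((x + 1#) ^ q * (y + 1#) ^ q)        ≈⟨ *-congˡ (*-congˡ (^-congˡ q ([w+1]^q≈w^q+1 x))) ⟨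
      (x + 1#) * ((x + 1#) ^ q * ((x + 1#) ^ q) ^ q)  ≈⟨ N≈w*w^q*[w^q]^q (x + 1#) ⟨
      N q (x + 1#)                                    ≈⟨ proj₂ (proj₂ x∈S4) ⟩
      - 1#                                            ∎)

    X≈C*u*u : X ≈ C * (u * u)
    X≈C*u*u = begin
      X                ≈⟨ [x-a][x-a*a]≈x²+x+1 x ⟨
      u * (x - a * a)  ≈⟨ *-congˡ C-def ⟨
      u * (C * u)      ≈⟨ solve 2 (λ u C → u :* (C :* u) := C :* (u :* u)) refl u C ⟩
      C * (u * u)      ∎

    q²≡1+3j⇒X≉0 : ∀ j → q ℕ.* q ≡ 1 ℕ.+ 3 ℕ.* j → ¬ (X ≈ 0#)
    q²≡1+3j⇒X≉0 j q²≡1+3j X≈0 = x∉Fq (begin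
      x ^ q                  ≈⟨ ^-congˡ q x^q²≈x ⟨
      (x ^ (q ℕ.* q)) ^ q    ≈⟨ ^-assocʳ x (q ℕ.* q) q ⟩
      x ^ (q ℕ.* q ℕ.* q)    ≡⟨ ≡.cong (x ^_) (n*n*n≡n^3 q) ⟩
      x ^ (q ℕ.^ 3)          ≈⟨ proj₁ x∈S4 ⟩
      x                      ∎)
      where
      x^q²≈x : x ^ (q ℕ.* q) ≈ x
      x^q²≈x = trans (^-mod 3 1 j (CubeRootOfUnity.a³≈1 x X≈0) q²≡1+3j) (*-identityʳ x)

    u≉0 : ¬ (X ≈ 0#) → ¬ (u ≈ 0#)
    u≉0 X≉0 = *-≉0ˡ (*-≉0ʳ (λ C*u*u≈0 → X≉0 (trans X≈C*u*u C*u*u≈0)))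

    C≉0 : ¬ (X ≈ 0#) → ¬ (C ≈ 0#)
    C≉0 X≉0 = *-≉0ˡ (λ C*u*u≈0 → X≉0 (trans X≈C*u*u C*u*u≈0))

    u^q≈y-a^q : u ^ q ≈ y - a ^ q
    u^q≈y-a^q = additivePower-- additive-q x a

    C^q*u^q≈y-[a*a]^q : C ^ q * u ^ q ≈ y - (a * a) ^ q
    C^q*u^q≈y-[a*a]^q = begin
      C ^ q * u ^ q    ≈⟨ ^-distrib-* C u q ⟨
      (C * u) ^ q      ≈⟨ ^-congˡ q C-def ⟩
      (x - a * a) ^ q  ≈⟨ additivePower-- additive-q x (a * a) ⟩
      y - (a * a) ^ q  ∎

    u^q³≈x-a^q³ : u ^ (q ℕ.^ 3) ≈ x - a ^ (q ℕ.^ 3)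
    u^q³≈x-a^q³ = trans (additivePower-- {{m^n≢0 q 3}} (additivePower-^ {q} additive-q 3) x a) (+-congʳ (proj₁ x∈S4))

    X^E≈C^E*u^[E+E] : ∀ E → X ^ E ≈ C ^ E * u ^ (E ℕ.+ E)
    X^E≈C^E*u^[E+E] E = begin
      X ^ E                  ≈⟨ ^-congˡ E X≈C*u*u ⟩
      (C * (u * u)) ^ E      ≈⟨ ^-distrib-* C (u * u) E ⟩
      C ^ E * (u * u) ^ E    ≈⟨ *-congˡ ([w*w]^n≈w^[n+n] u E) ⟩
      C ^ E * u ^ (E ℕ.+ E)  ∎

    proportional⇒k³≈m³ : ∀ {k m P} → ¬ (P ≈ 0#) →
                         (y - a * a) * u ≈ k * P → (x - a * a) * (y - a) ≈ m * P → k ^ 3 ≈ m ^ 3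
    proportional⇒k³≈m³ {k} {m} {P} P≉0 A≈kP B≈mP =
      [t-as][t-aas]≈0⇒t³≈s³ (*≈0⇒≈0 (*-≉0 P≉0 P≉0) (begin
      (P * P) * ((k - a * m) * (k - a * a * m))
        ≈⟨ solve 4 (λ P k m a → (P :* P) :* ((k :- a :* m) :* (k :- a :* a :* m)) :=
                                (k :* P :- a :* (m :* P)) :* (k :* P :- a :* a :* (m :* P))) refl P k m a ⟩
      (k * P - a * (m * P)) * (k * P - a * a * (m * P))
        ≈⟨ *-cong (+-cong A≈kP (-‿cong (*-congˡ B≈mP))) (+-cong A≈kP (-‿cong (*-congˡ B≈mP))) ⟨
      (A - a * B) * (A - a * a * B)  ≈⟨ [xy+y+1][xy+x+1]≈0⇒[A-aB][A-aaB]≈0 x y [xy+y+1][xy+x+1]≈0 ⟩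
      0#                             ∎))
      where
      A B : Carrier
      A = (y - a * a) * u
      B = (x - a * a) * (y - a)

    module OneMod6 (n : ℕ) (q≡1+6n : q ≡ 1 ℕ.+ n ℕ.* 6) where
      h E : ℕ
      h = n ℕ.* 9
      E = h ℕ.+ (h ℕ.+ h) ℕ.* (n ℕ.* n ℕ.* 6 ℕ.+ n ℕ.* 3)

      at-q : ∀ (f : ℕ → ℕ) {r} → f (1 ℕ.+ n ℕ.* 6) ≡ r → f q ≡ r
      at-q f f[1+6n]≡r = ≡.trans (≡.cong f q≡1+6n) f[1+6n]≡r

      ordG≡h+h : ordG q ≡ h ℕ.+ h
      ordG≡h+h = ≡.trans (ordG-1mod3 {q} (at-q (ℕ._% 3) ([1+6n]%3≡1 n)))
                         (at-q (λ r → 3 ℕ.* (r ∸ 1)) (3*6n≡9n+9n n))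

      q³≡1+E+E : q ℕ.^ 3 ≡ suc (E ℕ.+ E)
      q³≡1+E+E = ≡.trans (≡.sym (n*n*n≡n^3 q)) (at-q (λ r → r ℕ.* r ℕ.* r) ([1+6n]³≡1+2E n))

      X≉0 : ¬ (X ≈ 0#)
      X≉0 = q²≡1+3j⇒X≉0 (n ℕ.* 4 ℕ.+ n ℕ.* n ℕ.* 12) (at-q (λ r → r ℕ.* r) ([1+6n]²≡1+3j n))

      a^q≈a : a ^ q ≈ a
      a^q≈a = trans (^-mod 3 1 (n ℕ.* 2) a³≈1 (at-q (λ r → r) (1+6n≡1+3[2n] n))) (*-identityʳ a)

      a^q³≈a : a ^ (q ℕ.^ 3) ≈ a
      a^q³≈a = trans (^-mod 3 1 (n ℕ.* 6 ℕ.+ n ℕ.* n ℕ.* 36 ℕ.+ n ℕ.* n ℕ.* n ℕ.* 72) a³≈1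
                       (≡.trans (≡.sym (n*n*n≡n^3 q)) (at-q (λ r → r ℕ.* r ℕ.* r) ([1+6n]³≡1+3j n))))
                     (*-identityʳ a)

      u^q≈y-a : u ^ q ≈ y - a
      u^q≈y-a = trans u^q≈y-a^q (+-congˡ (-‿cong a^q≈a))

      C^q*[y-a]≈y-a*a : C ^ q * (y - a) ≈ y - a * a
      C^q*[y-a]≈y-a*a = begin
        C ^ q * (y - a)  ≈⟨ *-congˡ u^q≈y-a ⟨
        C ^ q * u ^ q    ≈⟨ C^q*u^q≈y-[a*a]^q ⟩
        y - (a * a) ^ q  ≈⟨ +-congˡ (-‿cong (trans (^-distrib-* a a q) (*-cong a^q≈a a^q≈a))) ⟩
        y - a * a        ∎

      C^[h+h]≈1 : C ^ (h ℕ.+ h) ≈ 1#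
      C^[h+h]≈1 = *-cancelˡ (^-≉0 (C≉0 X≉0) 3) (begin
        C ^ 3 * C ^ (h ℕ.+ h)  ≈⟨ ^-homo-* C 3 (h ℕ.+ h) ⟨
        C ^ (3 ℕ.+ (h ℕ.+ h))  ≡⟨ ≡.cong (C ^_) (at-q (ℕ._* 3) ([1+6n]*3≡3+18n n)) ⟨
        C ^ (q ℕ.* 3)          ≈⟨ ^-assocʳ C q 3 ⟨
        (C ^ q) ^ 3            ≈⟨ proportional⇒k³≈m³ P≉0 A≈C^q*P B≈C*P ⟩
        C ^ 3                  ≈⟨ *-identityʳ _ ⟨
        C ^ 3 * 1#             ∎)
        where
        P : Carrier
        P = u * (y - a)
        P≉0 : ¬ (P ≈ 0#)
        P≉0 = *-≉0 (u≉0 X≉0) (λ y-a≈0 → ^-≉0 (u≉0 X≉0) q (trans u^q≈y-a y-a≈0))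
        A≈C^q*P : (y - a * a) * u ≈ C ^ q * P
        A≈C^q*P = trans (*-congʳ (sym C^q*[y-a]≈y-a*a))
          (solve 3 (λ c v u → (c :* v) :* u := c :* (u :* v)) refl (C ^ q) (y - a) u)
        B≈C*P : (x - a * a) * (y - a) ≈ C * P
        B≈C*P = trans (*-congʳ (sym C-def)) (*-assoc C u (y - a))

      u^[E+E]≈1 : u ^ (E ℕ.+ E) ≈ 1#
      u^[E+E]≈1 = *-cancelˡ (u≉0 X≉0) (begin
        u * u ^ (E ℕ.+ E)  ≡⟨ ≡.cong (u ^_) q³≡1+E+E ⟨
        u ^ (q ℕ.^ 3)      ≈⟨ u^q³≈x-a^q³ ⟩
        x - a ^ (q ℕ.^ 3)  ≈⟨ +-congˡ (-‿cong a^q³≈a) ⟩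
        u                  ≈⟨ *-identityʳ u ⟨
        u * 1#             ∎)

      C^h≈X^E : C ^ h ≈ X ^ E
      C^h≈X^E = sym (begin
        X ^ E                  ≈⟨ X^E≈C^E*u^[E+E] E ⟩
        C ^ E * u ^ (E ℕ.+ E)  ≈⟨ *-congˡ u^[E+E]≈1 ⟩
        C ^ E * 1#             ≈⟨ *-identityʳ _ ⟩
        C ^ E                  ≈⟨ ^-mod (h ℕ.+ h) h (n ℕ.* n ℕ.* 6 ℕ.+ n ℕ.* 3) C^[h+h]≈1 ≡.refl ⟩
        C ^ h                  ∎)

      conclusion : ¬ (X ≈ 0#) × (SquareInG q C ⇔ NonzeroSquareInFq3 q X)
      conclusion = X≉0 , squares-agree q h E ordG≡h+h q³≡1+E+E X≉0 C^h≈X^E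

    module FiveMod6 (n : ℕ) (q≡5+6n : q ≡ 5 ℕ.+ n ℕ.* 6) where
      h E : ℕ
      h = 9 ℕ.+ n ℕ.* 9
      E = 8 ℕ.+ n ℕ.* 9 ℕ.+ (h ℕ.+ h) ℕ.* (n ℕ.* n ℕ.* 6 ℕ.+ n ℕ.* 9 ℕ.+ 3)

      at-q : ∀ (f : ℕ → ℕ) {r} → f (5 ℕ.+ n ℕ.* 6) ≡ r → f q ≡ r
      at-q f f[5+6n]≡r = ≡.trans (≡.cong f q≡5+6n) f[5+6n]≡r

      ordG≡h+h : ordG q ≡ h ℕ.+ h
      ordG≡h+h = ≡.trans (ordG-2mod3 {q} (at-q (ℕ._% 3) ([5+6n]%3≡2 n)))
                         (at-q (λ r → 3 ℕ.* (r ℕ.+ 1)) (3*[6+6n]≡18+18n n))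

      q³≡1+E+E : q ℕ.^ 3 ≡ suc (E ℕ.+ E)
      q³≡1+E+E = ≡.trans (≡.sym (n*n*n≡n^3 q)) (at-q (λ r → r ℕ.* r ℕ.* r) ([5+6n]³≡1+2E n))

      X≉0 : ¬ (X ≈ 0#)
      X≉0 = q²≡1+3j⇒X≉0 (8 ℕ.+ n ℕ.* 20 ℕ.+ n ℕ.* n ℕ.* 12) (at-q (λ r → r ℕ.* r) ([5+6n]²≡1+3j n))

      a^q≈a*a : a ^ q ≈ a * a
      a^q≈a*a = trans (^-mod 3 2 (1 ℕ.+ n ℕ.* 2) a³≈1 (at-q (λ r → r) (5+6n≡2+3[1+2n] n)))
                      (*-congˡ (*-identityʳ a))

      a^q³≈a*a : a ^ (q ℕ.^ 3) ≈ a * a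
      a^q³≈a*a = trans (^-mod 3 2 (41 ℕ.+ n ℕ.* 150 ℕ.+ n ℕ.* n ℕ.* 180 ℕ.+ n ℕ.* n ℕ.* n ℕ.* 72) a³≈1
                         (≡.trans (≡.sym (n*n*n≡n^3 q)) (at-q (λ r → r ℕ.* r ℕ.* r) ([5+6n]³≡2+3j n))))
                       (*-congˡ (*-identityʳ a))

      u^q≈y-a*a : u ^ q ≈ y - a * a
      u^q≈y-a*a = trans u^q≈y-a^q (+-congˡ (-‿cong a^q≈a*a))

      C^q*[y-a*a]≈y-a : C ^ q * (y - a * a) ≈ y - a
      C^q*[y-a*a]≈y-a = begin
        C ^ q * (y - a * a)  ≈⟨ *-congˡ u^q≈y-a*a ⟨
        C ^ q * u ^ q        ≈⟨ C^q*u^q≈y-[a*a]^q ⟩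
        y - (a * a) ^ q
          ≈⟨ +-congˡ (-‿cong (trans (^-distrib-* a a q) (trans (*-cong a^q≈a*a a^q≈a*a) [a*a]*[a*a]≈a))) ⟩
        y - a                ∎

      C^[h+h]≈1 : C ^ (h ℕ.+ h) ≈ 1#
      C^[h+h]≈1 = begin
        C ^ (h ℕ.+ h)      ≡⟨ ≡.cong (C ^_) (at-q (λ r → suc r ℕ.* 3) ([6+6n]*3≡18+18n n)) ⟨
        C ^ (suc q ℕ.* 3)  ≈⟨ ^-assocʳ C (suc q) 3 ⟨
        (C * C ^ q) ^ 3    ≈⟨ proportional⇒k³≈m³ A≉0 (sym (*-identityˡ A)) B≈C*C^q*A ⟨
        1# ^ 3             ≈⟨ 1#^n≈1# 3 ⟩
        1#                 ∎
        where
        A : Carrier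
        A = (y - a * a) * u
        A≉0 : ¬ (A ≈ 0#)
        A≉0 = *-≉0 (λ y-a*a≈0 → ^-≉0 (u≉0 X≉0) q (trans u^q≈y-a*a y-a*a≈0)) (u≉0 X≉0)
        B≈C*C^q*A : (x - a * a) * (y - a) ≈ (C * C ^ q) * A
        B≈C*C^q*A = trans (*-cong (sym C-def) (sym C^q*[y-a*a]≈y-a))
          (solve 4 (λ c d u v → (c :* u) :* (d :* v) := (c :* d) :* (v :* u)) refl C (C ^ q) u (y - a * a))

      u^[E+E]≈C : u ^ (E ℕ.+ E) ≈ C
      u^[E+E]≈C = *-cancelˡ (u≉0 X≉0) (begin
        u * u ^ (E ℕ.+ E)  ≡⟨ ≡.cong (u ^_) q³≡1+E+E ⟨
        u ^ (q ℕ.^ 3)      ≈⟨ u^q³≈x-a^q³ ⟩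
        x - a ^ (q ℕ.^ 3)  ≈⟨ +-congˡ (-‿cong a^q³≈a*a) ⟩
        x - a * a          ≈⟨ C-def ⟨
        C * u              ≈⟨ *-comm C u ⟩
        u * C              ∎)

      C^h≈X^E : C ^ h ≈ X ^ E
      C^h≈X^E = sym (begin
        X ^ E                  ≈⟨ X^E≈C^E*u^[E+E] E ⟩
        C ^ E * u ^ (E ℕ.+ E)  ≈⟨ *-congˡ u^[E+E]≈C ⟩
        C ^ E * C              ≈⟨ *-comm _ C ⟩
        C ^ suc E              ≈⟨ ^-mod (h ℕ.+ h) h (n ℕ.* n ℕ.* 6 ℕ.+ n ℕ.* 9 ℕ.+ 3) C^[h+h]≈1 ≡.refl ⟩
        C ^ h                  ∎)

      conclusion : ¬ (X ≈ 0#) × (SquareInG q C ⇔ NonzeroSquareInFq3 q X)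
      conclusion = X≉0 , squares-agree q h E ordG≡h+h q³≡1+E+E X≉0 C^h≈X^E

    conclusion : CoprimeTo6 q → ¬ (X ≈ 0#) × (SquareInG q C ⇔ NonzeroSquareInFq3 q X)
    conclusion (1+6n n q≡1+6n) = OneMod6.conclusion n q≡1+6n
    conclusion (5+6n n q≡5+6n) = FiveMod6.conclusion n q≡5+6n

mainTheorem14 : ∀ {c ℓ : Level} (K : CommutativeRing c ℓ) →
    let open CommutativeRing K
        open FieldNotions K
    in (p k : ℕ) → Prime p → p ≢ 2 → p ≢ 3 →
       IsAlgClosedFieldOfChar p →
       let q = p ℕ.^ suc k in
       (a : Carrier) → a * a + a + 1# ≈ 0# →
       (D : Carrier) → S4 q D → ¬ InF q D →
       (CD : Carrier) → CD * (D - a) ≈ D - a * a →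
       ¬ (D * D + D + 1# ≈ 0#) × (SquareInG q CD ⇔ NonzeroSquareInFq3 q (D * D + D + 1#))
mainTheorem14 K p k p-prime p≢2 p≢3 F a a²+a+1≈0 D D∈S4 D∉Fq C C-def =
  conclusion (coprimeTo6-^ (coprimeTo6-prime p-prime p≢2 p≢3) (suc k))
  where
  instance
    q≢0 : ℕ.NonZero (p ℕ.^ suc k)
    q≢0 = m^n≢0 p (suc k) {{prime⇒nonZero p-prime}}
  q-additive : AdditivePower K (p ℕ.^ suc k)
  q-additive = additivePower-^ K {p} (frobenius K p-prime (FieldNotions.IsAlgClosedFieldOfChar.charP F)) (suc k)
  open Setting K F (p ℕ.^ suc k) q-additive a a²+a+1≈0 D D∈S4 D∉Fq C C-def
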